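{- Let $G$ be a forbidden induced subgraph for the class of edge-apex cographs, and assume that $G$ or its complement $\overline{G}$ is disconnected. Then $G$ contains two vertex-disjoint induced copies of $P_4$, and $|V(G)|=8$.
   Context: All graphs are finite, simple and undirected. $P_4$ is the path on four vertices. A cograph is a graph generated from $K_1$ by complementation and disjoint union; equivalently, a graph with no induced subgraph isomorphic to $P_4$. A graph $G$ is an edge-apex cograph if $G$ is a cograph or $G$ has an edge $e$ such that $G-e$ (delete the edge, keep all vertices) is a cograph; this class is closed under induced subgraphs. A forbidden induced subgraph for the class of edge-apex cographs is a graph that is not an edge-apex cograph but all of whose proper induced subgraphs are edge-apex cographs. $\overline{G}$ denotes the complement of $G$. -}

module Defs where

open import Data.Nat using (ℕ; suc; _<_; _≡ᵇ_)
open import Data.Fin using (Fin; toℕ; _≟_)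
open import Data.Bool using (Bool; true; false; not; _∧_; _∨_; if_then_else_)
open import Data.Product using (Σ; _×_; _,_)
open import Data.Sum using (_⊎_)
open import Relation.Nullary using (¬_; does)
open import Relation.Binary.PropositionalEquality using (_≡_; _≢_)
open import Function.Definitions using (Injective)

record Graph (n : ℕ) : Set where
  field
    adj    : Fin n → Fin n → Bool
    sym    : ∀ x y → adj x y ≡ adj y x
    irrefl : ∀ x → adj x x ≡ false
open Graph public

_==_ : ∀ {n} → Fin n → Fin n → Bool
x == y = does (x ≟ y)

P4adj : Fin 4 → Fin 4 → Bool
P4adj i j = (suc (toℕ i) ≡ᵇ toℕ j) ∨ (suc (toℕ j) ≡ᵇ toℕ i)

IsInducedEmbedding : ∀ {m n} → (Fin m → Fin m → Bool) → Graph n → (Fin m → Fin n) → Set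
IsInducedEmbedding {m} H G f = Injective _≡_ _≡_ f × (∀ (i j : Fin m) → adj G (f i) (f j) ≡ H i j)

InducedP4 : ∀ {n} → Graph n → (Fin 4 → Fin n) → Set
InducedP4 G f = IsInducedEmbedding P4adj G f

IsCograph : ∀ {n} → Graph n → Set
IsCograph {n} G = ¬ (Σ (Fin 4 → Fin n) λ f → InducedP4 G f)

deleteEdge : ∀ {n} → Graph n → Fin n → Fin n → Graph n
deleteEdge {n} G u v = record
  { adj = a ; sym = s ; irrefl = r }
  where
  hit : Fin n → Fin n → Bool
  hit x y = ((x == u) ∧ (y == v)) ∨ ((x == v) ∧ (y == u))
  a : Fin n → Fin n → Bool
  a x y = adj G x y ∧ not (hit x y)
  open import Data.Bool.Properties using (∨-comm)
  open import Relation.Binary.PropositionalEquality using (cong₂; refl)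
  s : ∀ x y → a x y ≡ a y x
  s x y = cong₂ (λ p q → p ∧ not q) (sym G x y) (∨-comm ((x == u) ∧ (y == v)) ((x == v) ∧ (y == u)) ⟨trans⟩ lemma)
    where
    open import Relation.Binary.PropositionalEquality using () renaming (trans to _⟨trans⟩_)
    open import Data.Bool.Properties using (∧-comm)
    lemma : ((x == v) ∧ (y == u)) ∨ ((x == u) ∧ (y == v)) ≡ ((y == u) ∧ (x == v)) ∨ ((y == v) ∧ (x == u))
    lemma = cong₂ _∨_ (∧-comm (x == v) (y == u)) (∧-comm (x == u) (y == v))
  r : ∀ x → a x x ≡ false
  r x rewrite irrefl G x = refl

IsEdgeApexCograph : ∀ {n} → Graph n → Set
IsEdgeApexCograph {n} G =
  IsCograph G ⊎ (Σ (Fin n) λ u → Σ (Fin n) λ v → (adj G u v ≡ true) × IsCograph (deleteEdge G u v))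

induced : ∀ {m n} → Graph n → (Fin m → Fin n) → Graph m
induced G f = record
  { adj = λ i j → adj G (f i) (f j)
  ; sym = λ i j → sym G (f i) (f j)
  ; irrefl = λ i → irrefl G (f i) }

IsForbiddenEAC : ∀ {n} → Graph n → Set
IsForbiddenEAC {n} G =
  ¬ IsEdgeApexCograph G ×
  (∀ (m : ℕ) (f : Fin m → Fin n) → Injective _≡_ _≡_ f → m < n → IsEdgeApexCograph (induced G f))

complement : ∀ {n} → Graph n → Graph n
complement {n} G = record { adj = a ; sym = s ; irrefl = r }
  where
  open import Relation.Binary.PropositionalEquality using (refl; cong)
  open import Relation.Nullary using (yes; no)
  a : Fin n → Fin n → Bool
  a x y = if x == y then false else not (adj G x y)
  s : ∀ x y → a x y ≡ a y x
  s x y with x ≟ y | y ≟ x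
  ... | yes _ | yes _ = refl
  ... | yes p | no q = Data.Empty.⊥-elim (q (Relation.Binary.PropositionalEquality.sym p))
    where import Data.Empty
  ... | no q | yes p = Data.Empty.⊥-elim (q (Relation.Binary.PropositionalEquality.sym p))
    where import Data.Empty
  ... | no _ | no _ = cong not (sym G x y)
  r : ∀ x → a x x ≡ false
  r x with x ≟ x
  ... | yes _ = refl
  ... | no q = Data.Empty.⊥-elim (q refl)
    where import Data.Empty

data Reachable {n} (G : Graph n) : Fin n → Fin n → Set where
  here : ∀ {x} → Reachable G x x
  step : ∀ {x y z} → adj G x y ≡ true → Reachable G y z → Reachable G x z

Connected : ∀ {n} → Graph n → Set
Connected {n} G = ∀ (x y : Fin n) → Reachable G x y

Disconnected : ∀ {n} → Graph n → Set
Disconnected G = ¬ Connected G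

{-# OPTIONS --safe #-}
-- Let K be whichever of G and its complement is disconnected, and f an induced P4 of G.
-- P4 and its complement are both connected, so every induced P4 lies inside one
-- component of K. Take w off f. By minimality G - w is edge-apex via some edge uv, and
-- uv has both ends on f, since otherwise f survives in G - w - uv. As G is not
-- edge-apex, G - uv contains an induced P4 p, which must pass through w. The graphs
-- K (G - uv) and K G differ only at u and v, which lie on f, so if p meets f then w lies
-- in the component of f. Otherwise p avoids u and is an induced P4 of G disjoint from f.
-- As K is disconnected, the second case occurs for some w. Two disjoint induced P4s
-- survive the deletion of any single edge, so they span an 8-vertex induced subgraph
-- that is not edge-apex, and minimality gives n = 8.
module Submission where

open import Defs
open import Data.Nat using (ℕ; zero; suc; _≡ᵇ_)
open import Data.Nat.Properties using (≤-antisym; ≮⇒≥; n<1+n)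
open import Data.Fin using (Fin; zero; suc; toℕ; #_; _≟_; punchIn; punchOut; splitAt; join; _↑ˡ_; _↑ʳ_)
open import Data.Fin.Properties using (any?; all?; punchIn-injective; punchIn-punchOut; join-splitAt; injective⇒≤)
open import Data.Vec.Functional using (_∷_; head; tail; _++_)
open import Data.Vec.Functional.Properties using (lookup-++ˡ; lookup-++ʳ)
open import Data.Bool using (Bool; true; false; not; _∧_; _∨_; if_then_else_)
open import Data.Bool.Properties using (∧-identityʳ; ∧-zeroʳ; ∨-comm) renaming (_≟_ to _≟ᵇ_)
open import Data.Product using (Σ; ∃; _×_; _,_; proj₁; proj₂)
open import Data.Sum using (_⊎_; inj₁; inj₂; [_,_]′)
open import Data.Empty using (⊥-elim)
open import Function using (_∘_; id; mk⇔)
open import Function.Definitions using (Injective)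
open import Relation.Nullary using (¬_; Dec; yes; no)
open import Relation.Nullary.Decidable using (dec-false; does-⇔; map′; decidable-stable; _×-dec_; _→-dec_; ¬?)
open import Relation.Binary.PropositionalEquality as ≡ using (_≡_; _≢_; _≗_; refl; cong; cong₂)

==-false : ∀ {n} {x y : Fin n} → x ≢ y → (x == y) ≡ false
==-false {x = x} {y} = dec-false (x ≟ y)

injective-preserves-== : ∀ {k n} {h : Fin k → Fin n} → Injective _≡_ _≡_ h →
  ∀ x y → (x == y) ≡ (h x == h y)
injective-preserves-== {h = h} h-inj x y = does-⇔ (mk⇔ (cong h) h-inj) (x ≟ y) (h x ≟ h y)

_∈_ : ∀ {k n} → Fin n → (Fin k → Fin n) → Set
x ∈ q = ∃ λ i → q i ≡ x

_∉_ : ∀ {k n} → Fin n → (Fin k → Fin n) → Set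
x ∉ q = ¬ x ∈ q

_∈?_ : ∀ {k n} (x : Fin n) (q : Fin k → Fin n) → Dec (x ∈ q)
x ∈? q = any? λ i → q i ≟ x

Disjoint : ∀ {k l n} → (Fin k → Fin n) → (Fin l → Fin n) → Set
Disjoint f g = ∀ i j → f i ≢ g j

disjoint? : ∀ {k l n} (f : Fin k → Fin n) (g : Fin l → Fin n) → Dec (Disjoint f g)
disjoint? f g = all? λ i → all? λ j → ¬? (f i ≟ g j)

anyFunction? : ∀ {m n} {P : (Fin m → Fin n) → Set} →
  (∀ {f g} → f ≗ g → P f → P g) → (∀ f → Dec (P f)) → Dec (∃ P)
anyFunction? {zero} resp P? = map′ (_ ,_) (λ (f , p) → resp (λ ()) p) (P? λ ())
anyFunction? {suc m} resp P? =
  map′ (λ (x , f , p) → x ∷ f , p) (λ (f , p) → head f , tail f , resp (head∷tail {f}) p)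
       (any? λ x → anyFunction? (resp ∘ ∷-congʳ) (P? ∘ (x ∷_)))
  where
  head∷tail : ∀ {f : Fin (suc m) → _} → f ≗ head f ∷ tail f
  head∷tail zero    = refl
  head∷tail (suc i) = refl
  ∷-congʳ : ∀ {x} {f g : Fin m → _} → f ≗ g → x ∷ f ≗ x ∷ g
  ∷-congʳ f≗g zero    = refl
  ∷-congʳ f≗g (suc i) = f≗g i

module _ {k : ℕ} {H : Fin k → Fin k → Bool} where

  embedding-transfer : ∀ {m n} {Y : Graph m} {X : Graph n} {p : Fin k → Fin m} {q : Fin k → Fin n} →
    (∀ {i j} → p i ≡ p j → q i ≡ q j) → (∀ i j → adj Y (p i) (p j) ≡ adj X (q i) (q j)) →
    IsInducedEmbedding H X q → IsInducedEmbedding H Y p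
  embedding-transfer p≡⇒q≡ adj≡ (q-inj , q-adj) = q-inj ∘ p≡⇒q≡ , λ i j → ≡.trans (adj≡ i j) (q-adj i j)

  embedding-adj-cong : ∀ {n} {Y X : Graph n} {q : Fin k → Fin n} →
    (∀ i j → adj Y (q i) (q j) ≡ adj X (q i) (q j)) →
    IsInducedEmbedding H X q → IsInducedEmbedding H Y q
  embedding-adj-cong {Y = Y} {X} = embedding-transfer {Y = Y} {X} id

  embedding-induced : ∀ {m n} (X : Graph n) (h : Fin m → Fin n) {p : Fin k → Fin m} {q : Fin k → Fin n} →
    (∀ i → h (p i) ≡ q i) → IsInducedEmbedding H X q → IsInducedEmbedding H (induced X h) p
  embedding-induced X h hp≡q = embedding-transfer {Y = induced X h} {X}
    (λ {i} {j} pi≡pj → ≡.trans (≡.sym (hp≡q i)) (≡.trans (cong h pi≡pj) (hp≡q j)))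
    (λ i j → cong₂ (adj X) (hp≡q i) (hp≡q j))

  embedding-≗ : ∀ {n} {X : Graph n} {p q : Fin k → Fin n} →
    p ≗ q → IsInducedEmbedding H X p → IsInducedEmbedding H X q
  -- induced X id is X up to η.
  embedding-≗ {X = X} p≗q = embedding-induced X id (≡.sym ∘ p≗q)

  isInducedEmbedding? : ∀ {n} (X : Graph n) (q : Fin k → Fin n) → Dec (IsInducedEmbedding H X q)
  isInducedEmbedding? X q =
    map′ (λ (inj , a) → (λ {i} {j} → inj i j) , a) (λ (inj , a) → (λ i j → inj) , a)
         ((all? λ i → all? λ j → (q i ≟ q j) →-dec (i ≟ j))
           ×-dec (all? λ i → all? λ j → adj X (q i) (q j) ≟ᵇ H i j))

complement-embedding : ∀ {k n} {H : Graph k} {X : Graph n} {p : Fin k → Fin n} →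
  IsInducedEmbedding (adj H) X p → IsInducedEmbedding (adj (complement H)) (complement X) p
complement-embedding (p-inj , p-adj) =
  p-inj , λ i j → cong₂ (λ b c → if b then false else not c)
                        (≡.sym (injective-preserves-== p-inj i j)) (p-adj i j)

inducedP4? : ∀ {n} (X : Graph n) → Dec (∃ (InducedP4 X))
inducedP4? X = anyFunction? (embedding-≗ {X = X}) (isInducedEmbedding? X)

¬cograph⇒inducedP4 : ∀ {n} {X : Graph n} → ¬ IsCograph X → ∃ (InducedP4 X)
¬cograph⇒inducedP4 {X = X} = decidable-stable (inducedP4? X)

P4 : Graph 4
P4 = record { adj = P4adj ; sym = λ i j → ∨-comm (suc (toℕ i) ≡ᵇ toℕ j) _ ; irrefl = irrefl′ }
  where
  irrefl′ : ∀ i → P4adj i i ≡ false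
  irrefl′ zero                   = refl
  irrefl′ (suc zero)             = refl
  irrefl′ (suc (suc zero))       = refl
  irrefl′ (suc (suc (suc zero))) = refl

Reachable-trans : ∀ {n} {X : Graph n} {x y z} → Reachable X x y → Reachable X y z → Reachable X x z
Reachable-trans here         y⇝z = y⇝z
Reachable-trans (step e x⇝y) y⇝z = step e (Reachable-trans x⇝y y⇝z)

Reachable-sym : ∀ {n} {X : Graph n} {x y} → Reachable X x y → Reachable X y x
Reachable-sym here = here
Reachable-sym {X = X} (step {x} {y} e y⇝z) =
  Reachable-trans (Reachable-sym y⇝z) (step (≡.trans (sym X y x) e) here)

Reachable-map : ∀ {m n} {H : Graph m} {X : Graph n} {h : Fin m → Fin n} →
  (∀ {a b} → adj H a b ≡ true → adj X (h a) (h b) ≡ true) →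
  ∀ {a b} → Reachable H a b → Reachable X (h a) (h b)
Reachable-map edge here         = here
Reachable-map edge (step e a⇝b) = step (edge e) (Reachable-map edge a⇝b)

connected-from : ∀ {n} {X : Graph n} r → (∀ x → Reachable X r x) → Connected X
connected-from r r⇝ x y = Reachable-trans (Reachable-sym (r⇝ x)) (r⇝ y)

P4-connected : Connected P4
P4-connected = connected-from zero λ where
  zero                   → here
  (suc zero)             → step refl here
  (suc (suc zero))       → step {y = # 1} refl (step refl here)
  (suc (suc (suc zero))) → step {y = # 1} refl (step {y = # 2} refl (step refl here))

complement-P4-connected : Connected (complement P4)
complement-P4-connected = connected-from zero λ where
  zero                   → here
  (suc zero)             → step {y = # 3} refl (step refl here)
  (suc (suc zero))       → step refl here
  (suc (suc (suc zero))) → step refl here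

P4-reachable : ∀ {n} {X : Graph n} {p} → InducedP4 X p → ∀ i j → Reachable X (p i) (p j)
P4-reachable (_ , p-adj) i j = Reachable-map (≡.trans (p-adj _ _)) (P4-connected i j)

P4-complement-reachable : ∀ {n} {X : Graph n} {p} → InducedP4 X p →
  ∀ i j → Reachable (complement X) (p i) (p j)
P4-complement-reachable {X = X} {p} p-P4 i j =
  Reachable-map (λ {a} {b} → ≡.trans (proj₂ (complement-embedding {H = P4} {X} {p} p-P4) a b))
                (complement-P4-connected i j)

module _ {n} (X : Graph n) {u v x y : Fin n} where

  adj-deleteEdge-unmarked : ((x == u) ∧ (y == v)) ∨ ((x == v) ∧ (y == u)) ≡ false →
    adj (deleteEdge X u v) x y ≡ adj X x y
  adj-deleteEdge-unmarked unmarked =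
    ≡.trans (cong (λ b → adj X x y ∧ not b) unmarked) (∧-identityʳ (adj X x y))

  adj-deleteEdge-nonEndpoint : x ≢ u → x ≢ v → adj (deleteEdge X u v) x y ≡ adj X x y
  adj-deleteEdge-nonEndpoint x≢u x≢v = adj-deleteEdge-unmarked
    (cong₂ _∨_ (cong (_∧ (y == v)) (==-false x≢u)) (cong (_∧ (y == u)) (==-false x≢v)))

  adj-deleteEdge-avoidingˡ : x ≢ u → y ≢ u → adj (deleteEdge X u v) x y ≡ adj X x y
  adj-deleteEdge-avoidingˡ x≢u y≢u = adj-deleteEdge-unmarked
    (cong₂ _∨_ (cong (_∧ (y == v)) (==-false x≢u))
               (≡.trans (cong ((x == v) ∧_) (==-false y≢u)) (∧-zeroʳ (x == v))))

  adj-deleteEdge-avoidingʳ : x ≢ v → y ≢ v → adj (deleteEdge X u v) x y ≡ adj X x y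
  adj-deleteEdge-avoidingʳ x≢v y≢v = adj-deleteEdge-unmarked
    (cong₂ _∨_ (≡.trans (cong ((x == u) ∧_) (==-false y≢v)) (∧-zeroʳ (x == u)))
               (cong (_∧ (y == u)) (==-false x≢v)))

adj-deleteEdge-induced : ∀ {k n} (X : Graph n) {h : Fin k → Fin n} → Injective _≡_ _≡_ h →
  ∀ u v x y → adj (deleteEdge (induced X h) u v) x y ≡ adj (induced (deleteEdge X (h u) (h v)) h) x y
adj-deleteEdge-induced X {h} h-inj u v x y =
  cong (λ b → adj X (h x) (h y) ∧ not b)
       (cong₂ _∨_ (cong₂ _∧_ (h-== x u) (h-== y v)) (cong₂ _∧_ (h-== x v) (h-== y u)))
  where
  h-== : ∀ a b → (a == b) ≡ (h a == h b)
  h-== = injective-preserves-== h-inj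

module _ {n} (X : Graph n) (u v : Fin n) {q : Fin 4 → Fin n} where

  InducedP4-deleteEdge : InducedP4 X q → u ∉ q ⊎ v ∉ q → InducedP4 (deleteEdge X u v) q
  InducedP4-deleteEdge q-P4 (inj₁ u∉q) = embedding-adj-cong {Y = deleteEdge X u v} {X}
    (λ i j → adj-deleteEdge-avoidingˡ X (u∉q ∘ (i ,_)) (u∉q ∘ (j ,_))) q-P4
  InducedP4-deleteEdge q-P4 (inj₂ v∉q) = embedding-adj-cong {Y = deleteEdge X u v} {X}
    (λ i j → adj-deleteEdge-avoidingʳ X (v∉q ∘ (i ,_)) (v∉q ∘ (j ,_))) q-P4

  InducedP4-undeleteEdge : InducedP4 (deleteEdge X u v) q → u ∉ q → InducedP4 X q
  InducedP4-undeleteEdge q-P4 u∉q = embedding-adj-cong {Y = X} {deleteEdge X u v}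
    (λ i j → ≡.sym (adj-deleteEdge-avoidingˡ X (u∉q ∘ (i ,_)) (u∉q ∘ (j ,_)))) q-P4

deleteVertex : ∀ {m} → Graph (suc m) → Fin (suc m) → Graph m
deleteVertex X w = induced X (punchIn w)

punchIn-injective′ : ∀ {m} (w : Fin (suc m)) → Injective _≡_ _≡_ (punchIn w)
punchIn-injective′ w {x} {y} = punchIn-injective w x y

deleteVertex-edgeApex : ∀ {m} (G : Graph (suc m)) → IsForbiddenEAC G →
  ∀ w → IsEdgeApexCograph (deleteVertex G w)
deleteVertex-edgeApex {m} _ (_ , minimal) w = minimal m (punchIn w) (punchIn-injective′ w) (n<1+n m)

InducedP4-deleteVertex : ∀ {m} (X : Graph (suc m)) {w q} →
  InducedP4 X q → w ∉ q → ∃ (InducedP4 (deleteVertex X w))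
InducedP4-deleteVertex X {w} {q} q-P4 w∉q =
  punchOut ∘ w≢q , embedding-induced X (punchIn w) (punchIn-punchOut ∘ w≢q) q-P4
  where
  w≢q : ∀ i → w ≢ q i
  w≢q i w≡qi = w∉q (i , ≡.sym w≡qi)

DisjointP4s : ∀ {n} → Graph n → Set
DisjointP4s {n} X = Σ (Fin 4 → Fin n) λ f → Σ (Fin 4 → Fin n) λ g →
  InducedP4 X f × InducedP4 X g × Disjoint f g

disjointP4s⇒¬edgeApex : ∀ {n} {X : Graph n} → DisjointP4s X → ¬ IsEdgeApexCograph X
disjointP4s⇒¬edgeApex (f , g , f-P4 , g-P4 , f∩g=∅) (inj₁ cograph) = cograph (f , f-P4)
disjointP4s⇒¬edgeApex {X = X} (f , g , f-P4 , g-P4 , f∩g=∅) (inj₂ (u , v , _ , cograph))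
  with u ∈? f
... | no u∉f         = cograph (f , InducedP4-deleteEdge X u v f-P4 (inj₁ u∉f))
... | yes (i , fi≡u) = cograph (g , InducedP4-deleteEdge X u v g-P4 (inj₁ λ (j , gj≡u) →
                         f∩g=∅ i j (≡.trans fi≡u (≡.sym gj≡u))))

[,]-injective : ∀ {k l n} {f : Fin k → Fin n} {g : Fin l → Fin n} →
  Injective _≡_ _≡_ f → Injective _≡_ _≡_ g → Disjoint f g → Injective _≡_ _≡_ [ f , g ]′
[,]-injective f-inj g-inj f∩g=∅ {inj₁ i} {inj₁ j} e = cong inj₁ (f-inj e)
[,]-injective f-inj g-inj f∩g=∅ {inj₁ i} {inj₂ j} e = ⊥-elim (f∩g=∅ i j e)
[,]-injective f-inj g-inj f∩g=∅ {inj₂ i} {inj₁ j} e = ⊥-elim (f∩g=∅ j i (≡.sym e))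
[,]-injective f-inj g-inj f∩g=∅ {inj₂ i} {inj₂ j} e = cong inj₂ (g-inj e)

splitAt-injective : ∀ m {n} → Injective _≡_ _≡_ (splitAt m {n})
splitAt-injective m {n} {x} {y} e = begin
  x                      ≡⟨ join-splitAt m n x ⟨
  join m n (splitAt m x) ≡⟨ cong (join m n) e ⟩
  join m n (splitAt m y) ≡⟨ join-splitAt m n y ⟩
  y                      ∎
  where open ≡.≡-Reasoning

disjoint-++-injective : ∀ {k l n} {f : Fin k → Fin n} {g : Fin l → Fin n} →
  Injective _≡_ _≡_ f → Injective _≡_ _≡_ g → Disjoint f g → Injective _≡_ _≡_ (f ++ g)
disjoint-++-injective {k} f-inj g-inj f∩g=∅ = splitAt-injective k ∘ [,]-injective f-inj g-inj f∩g=∅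

forbidden∧disjointP4s⇒n≡8 : ∀ {n} (G : Graph n) → IsForbiddenEAC G → DisjointP4s G → n ≡ 8
forbidden∧disjointP4s⇒n≡8 {n} G (_ , minimal) (f , g , f-P4 , g-P4 , f∩g=∅) =
  ≤-antisym (≮⇒≥ {8} {n} λ 8<n → disjointP4s⇒¬edgeApex {X = G[f++g]} on-f++g (minimal 8 (f ++ g) f++g-inj 8<n))
            (injective⇒≤ f++g-inj)
  where
  G[f++g] : Graph 8
  G[f++g] = induced G (f ++ g)
  f++g-inj : Injective _≡_ _≡_ (f ++ g)
  f++g-inj = disjoint-++-injective (proj₁ f-P4) (proj₁ g-P4) f∩g=∅
  on-f++g : DisjointP4s G[f++g]
  on-f++g = (_↑ˡ 4) , (4 ↑ʳ_)
          , embedding-induced G (f ++ g) (lookup-++ˡ f g) f-P4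
          , embedding-induced G (f ++ g) (lookup-++ʳ f g) g-P4
          , λ i j e → f∩g=∅ i j (begin
              f i               ≡⟨ lookup-++ˡ f g i ⟨
              (f ++ g) (i ↑ˡ 4) ≡⟨ cong (f ++ g) e ⟩
              (f ++ g) (4 ↑ʳ j) ≡⟨ lookup-++ʳ f g j ⟩
              g j               ∎)
    where open ≡.≡-Reasoning

DisjointInducedP4 : ∀ {n} → Graph n → (Fin 4 → Fin n) → Set
DisjointInducedP4 X f = ∃ λ g → InducedP4 X g × Disjoint f g

disjointInducedP4? : ∀ {n} (X : Graph n) f → Dec (DisjointInducedP4 X f)
disjointInducedP4? X f = anyFunction? resp (λ g → isInducedEmbedding? X g ×-dec disjoint? f g)
  where
  resp : ∀ {g g′} → g ≗ g′ → InducedP4 X g × Disjoint f g → InducedP4 X g′ × Disjoint f g′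
  resp g≗g′ (g-P4 , f∩g=∅) =
    embedding-≗ {X = X} g≗g′ g-P4 , λ i j fi≡g′j → f∩g=∅ i j (≡.trans fi≡g′j (≡.sym (g≗g′ j)))

Reachable-lift : ∀ {n} {K K′ : Graph n} {r} →
  (∀ {x y} → adj K′ x y ≡ true → adj K x y ≡ true ⊎ Reachable K r x) →
  ∀ {a c} → Reachable K′ a c → Reachable K r c → Reachable K r a
Reachable-lift new-edge here         r⇝c = r⇝c
Reachable-lift new-edge (step e b⇝c) r⇝c with new-edge e
... | inj₁ e′  = Reachable-trans (Reachable-lift new-edge b⇝c r⇝c) (Reachable-sym (step e′ here))
... | inj₂ r⇝a = r⇝a

module ComponentArgument
  (K : ∀ {n} → Graph n → Graph n)
  (K-pointwise : ∀ {n} {X Y : Graph n} {x y} → adj X x y ≡ adj Y x y → adj (K X) x y ≡ adj (K Y) x y)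
  (P4-K-reachable : ∀ {n} {X : Graph n} {p} → InducedP4 X p → ∀ i j → Reachable (K X) (p i) (p j))
  where

  module _ {m} {G : Graph (suc m)} (forbidden : IsForbiddenEAC G) {f} (f-P4 : InducedP4 G f) where

    apexEdge : ∀ {w} → w ∉ f → Σ (Fin (suc m)) λ u → Σ (Fin (suc m)) λ v →
      adj G u v ≡ true × u ∈ f × v ∈ f × (∀ {p} → InducedP4 (deleteEdge G u v) p → w ∈ p)
    apexEdge {w} w∉f with deleteVertex-edgeApex G forbidden w
    ... | inj₁ cograph = ⊥-elim (cograph (InducedP4-deleteVertex G f-P4 w∉f))
    ... | inj₂ (u , v , uv , cograph) =
      U , V , uv
      , decidable-stable (U ∈? f) (f-meets-edge ∘ inj₁)
      , decidable-stable (V ∈? f) (f-meets-edge ∘ inj₂)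
      , λ p-P4 → decidable-stable (w ∈? _) (P4-avoiding-w p-P4)
      where
      U V : Fin (suc m)
      U = punchIn w u
      V = punchIn w v
      P4-avoiding-w : ∀ {q} → InducedP4 (deleteEdge G U V) q → ¬ w ∉ q
      P4-avoiding-w q-P4 w∉q with InducedP4-deleteVertex (deleteEdge G U V) q-P4 w∉q
      ... | p , p-P4 = cograph (p , embedding-adj-cong
        {Y = deleteEdge (deleteVertex G w) u v} {deleteVertex (deleteEdge G U V) w}
        (λ i j → adj-deleteEdge-induced G (punchIn-injective′ w) u v (p i) (p j)) p-P4)
      f-meets-edge : ¬ (U ∉ f ⊎ V ∉ f)
      f-meets-edge f-avoids = P4-avoiding-w (InducedP4-deleteEdge G U V f-P4 f-avoids) w∉f

    f-reachable : ∀ {x} → x ∈ f → Reachable (K G) (f zero) x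
    f-reachable (i , refl) = P4-K-reachable f-P4 zero i

    P4-meeting-f-reachable : ∀ {u v} → u ∈ f → v ∈ f → ∀ {p} → InducedP4 (deleteEdge G u v) p →
      ∀ {k} → p k ∈ f → ∀ {w} → w ∈ p → Reachable (K G) (f zero) w
    P4-meeting-f-reachable {u} {v} u∈f v∈f p-P4 {k} pk∈f (k′ , refl) =
      Reachable-lift new-edge (P4-K-reachable p-P4 k′ k) (f-reachable pk∈f)
      where
      new-edge : ∀ {x y} → adj (K (deleteEdge G u v)) x y ≡ true →
        adj (K G) x y ≡ true ⊎ Reachable (K G) (f zero) x
      new-edge {x} e with x ≟ u | x ≟ v
      ... | yes refl | _        = inj₂ (f-reachable u∈f)
      ... | no _     | yes refl = inj₂ (f-reachable v∈f)
      ... | no x≢u   | no x≢v   = inj₁ (≡.trans (≡.sym (K-pointwise (adj-deleteEdge-nonEndpoint G x≢u x≢v))) e)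

    reachable-unless-disjointP4 : ¬ DisjointInducedP4 G f → ∀ w → Reachable (K G) (f zero) w
    reachable-unless-disjointP4 none w with w ∈? f
    ... | yes w∈f = f-reachable w∈f
    ... | no w∉f with apexEdge w∉f
    ... | u , v , uv , u∈f , v∈f , through-w =
      via (¬cograph⇒inducedP4 {X = deleteEdge G u v} λ cograph → proj₁ forbidden (inj₂ (u , v , uv , cograph)))
      where
      -- A with on this P4 search (instead of the helper) takes minutes to typecheck.
      via : ∃ (InducedP4 (deleteEdge G u v)) → Reachable (K G) (f zero) w
      via (p , p-P4) = meets-or-disjoint (any? λ k → p k ∈? f)
        where
        meets-or-disjoint : Dec (∃ λ k → p k ∈ f) → Reachable (K G) (f zero) w
        meets-or-disjoint (yes (k , pk∈f)) = P4-meeting-f-reachable u∈f v∈f p-P4 pk∈f (through-w p-P4)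
        meets-or-disjoint (no p∩f=∅) = ⊥-elim (none (p , InducedP4-undeleteEdge G u v p-P4 u∉p , f∩p=∅))
          where
          f∩p=∅ : Disjoint f p
          f∩p=∅ i j fi≡pj = p∩f=∅ (j , i , fi≡pj)
          u∉p : u ∉ p
          u∉p (j , pj≡u) = f∩p=∅ (proj₁ u∈f) j (≡.trans (proj₂ u∈f) (≡.sym pj≡u))

  forbidden⇒disjointP4s : ∀ {n} (G : Graph n) → IsForbiddenEAC G → Disconnected (K G) → DisjointP4s G
  forbidden⇒disjointP4s {zero}  _ _ disconnected = ⊥-elim (disconnected λ ())
  forbidden⇒disjointP4s {suc m} G forbidden disconnected =
    around (¬cograph⇒inducedP4 {X = G} (proj₁ forbidden ∘ inj₁))
    where
    around : ∃ (InducedP4 G) → DisjointP4s G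
    around (f , f-P4) = extend (decidable-stable (disjointInducedP4? G f) λ none →
      disconnected (connected-from (f zero) (reachable-unless-disjointP4 forbidden f-P4 none)))
      where
      extend : DisjointInducedP4 G f → DisjointP4s G
      extend (g , g-P4 , f∩g=∅) = f , g , f-P4 , g-P4 , f∩g=∅

module OnGraph = ComponentArgument id id P4-reachable
module OnComplement = ComponentArgument complement
  (λ {_} {_} {_} {x} {y} → cong (λ b → if x == y then false else not b)) P4-complement-reachable

lemma3p1 : ∀ {n : ℕ} (G : Graph n) → IsForbiddenEAC G →
    (Disconnected G ⊎ Disconnected (complement G)) →
    (Σ (Fin 4 → Fin n) λ f → Σ (Fin 4 → Fin n) λ g →
       InducedP4 G f × InducedP4 G g × (∀ (i j : Fin 4) → f i ≢ g j))
    × n ≡ 8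
lemma3p1 G forbidden disconnected = disjointP4s , forbidden∧disjointP4s⇒n≡8 G forbidden disjointP4s
  where
  disjointP4s : DisjointP4s G
  disjointP4s = [ OnGraph.forbidden⇒disjointP4s G forbidden
                , OnComplement.forbidden⇒disjointP4s G forbidden ]′ disconnected
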